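{- Let $w\in\Sigma^n$ and $\ell_0\in\{1,\dots,n\}$. Suppose that for some integer $m$ and for every $\ell\in\{1,\dots,\ell_0\}$, $d_\ell(w)\le m\cdot \ell$. Then $C_{\rm LZ}(w)\le 4\left(m\log \ell_0 + \frac{n}{\ell_0}\right)$.
   Context: LZ77 compression of $w=w_1\cdots w_n$: starting from $t=1$, at each step find the longest substring $w_t\cdots w_{t+\ell-1}$ for which there is an index $p<t$ with $w_p\cdots w_{p+\ell-1}=w_t\cdots w_{t+\ell-1}$ (the two occurrences may overlap). If no such substring exists, output the symbol $w_t$ and set $t\leftarrow t+1$; otherwise output the pair $(p,\ell)$ and set $t\leftarrow t+\ell$. $C_{\rm LZ}(w)$ is the number of symbols (characters or pairs) in the output. $d_\ell(w)$ is the number of distinct substrings of length $\ell$ of $w$, counting all $n-\ell+1$ (possibly overlapping) length-$\ell$ substrings. -}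

module Defs where

open import Data.Nat using (ℕ; zero; suc; _+_; _*_; _∸_; _^_; _≤_; _<_; _<ᵇ_)
open import Data.Nat.Properties using (_≤?_)
open import Data.Bool using (Bool; true; false; if_then_else_)
open import Data.List using (List; []; _∷_; length; drop; take; map; upTo; deduplicate)
open import Data.List.Properties using (≡-dec)
open import Data.Product using (_×_; _,_; proj₁; proj₂)
open import Relation.Binary.Definitions using (DecidableEquality)
open import Relation.Nullary using (yes; no)

-- Words over an alphabet A with decidable equality are lists; n = length w.
-- Positions are 0-based internally (this does not affect any count).

lcp : {A : Set} → DecidableEquality A → List A → List A → ℕ
lcp _≟_ (x ∷ xs) (y ∷ ys) with x ≟ y
... | yes _ = suc (lcp _≟_ xs ys)
... | no  _ = 0
lcp _≟_ _ _ = 0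

-- For position t: best (p , ℓ) over candidate sources p < t, i.e. the largest ℓ
-- such that w[p..p+ℓ-1] = w[t..t+ℓ-1] for some p < t (overlaps allowed).
-- bestFrom considers p ∈ {0,…,k-1} (k ≤ t); ties resolved to the earliest p.
bestFrom : {A : Set} → DecidableEquality A → List A → ℕ → ℕ → ℕ × ℕ
bestFrom _≟_ w t zero = (0 , 0)
bestFrom _≟_ w t (suc k) =
  let b = bestFrom _≟_ w t k
      l = lcp _≟_ (drop k w) (drop t w)
  in if proj₂ b <ᵇ l then (k , l) else b

longestMatch : {A : Set} → DecidableEquality A → List A → ℕ → ℕ × ℕ
longestMatch _≟_ w t = bestFrom _≟_ w t t

data LZSym (A : Set) : Set where
  lit  : A → LZSym A
  pair : ℕ → ℕ → LZSym A

-- LZ77 parse of w starting from position t; the fuel argument bounds the number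
-- of steps (each step advances t by at least 1, so fuel = length w suffices).
lzFrom : {A : Set} → DecidableEquality A → List A → ℕ → ℕ → List (LZSym A)
lzFrom _≟_ w zero t = []
lzFrom _≟_ w (suc fuel) t with drop t w
... | [] = []
... | (c ∷ _) with longestMatch _≟_ w t
...   | (p , zero)    = lit c ∷ lzFrom _≟_ w fuel (suc t)
...   | (p , suc l)   = pair p (suc l) ∷ lzFrom _≟_ w fuel (t + suc l)

lz77 : {A : Set} → DecidableEquality A → List A → List (LZSym A)
lz77 _≟_ w = lzFrom _≟_ w (length w) 0

C-LZ : {A : Set} → DecidableEquality A → List A → ℕ
C-LZ _≟_ w = length (lz77 _≟_ w)

substringsOfLength : {A : Set} → ℕ → List A → List (List A)
substringsOfLength ℓ w = map (λ i → take ℓ (drop i w)) (upTo (suc (length w ∸ ℓ)))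

d : {A : Set} → DecidableEquality A → ℕ → List A → ℕ
d _≟_ ℓ w = length (deduplicate (≡-dec _≟_) (substringsOfLength ℓ w))

-- The real inequality  c ≤ 4 (m · log₂ ℓ₀ + n / ℓ₀)  (for ℓ₀ ≥ 1) encoded
-- exactly over ℕ: multiply by ℓ₀, get ℓ₀c - 4n ≤ 4 m ℓ₀ log₂ ℓ₀, and
-- exponentiate base 2:  2^(ℓ₀ c ∸ 4n) ≤ ℓ₀^(4 m ℓ₀).
-- (If ℓ₀c ≤ 4n both sides hold trivially; otherwise 2^x ≤ ℓ₀^y ⇔ x ≤ y·log₂ ℓ₀.)
LZBound : ℕ → ℕ → ℕ → ℕ → Set
LZBound c m ℓ₀ n = 2 ^ (ℓ₀ * c ∸ 4 * n) ≤ ℓ₀ ^ (4 * m * ℓ₀)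

{-# OPTIONS --safe #-}
-- The LZ77 parse cuts w into phrases such that every phrase but the last, extended
-- by one letter, occurs in w for the first time at its own start. Take a scale s and
-- a phrase of length l ∈ [s, 2s) starting at t with n ≥ t + 3s: every window of length
-- 3s starting in (t - s, t] contains the extended phrase, so it is the first occurrence
-- of its content. Phrases of this scale are at least s apart, so these blocks of starts
-- are disjoint and there are at most (d_{3s}(w) + s - 1)/s ≤ 3m such phrases, plus at
-- most two among the last 3s positions. With 2^{J+1} ≤ ℓ₀ < 2^{J+2}, summing over the
-- scales 2^j (j < J) and counting the phrases of length ≥ 2^J > ℓ₀/4 by their total
-- length gives c ≤ 1 + (3m + 2) J + 4n/ℓ₀, which is below 4(m log₂ ℓ₀ + n/ℓ₀) for
-- m ≥ 2. For m ≤ 1 the word is a power of one letter and has at most two phrases.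
module Submission where

open import Defs
open import Data.Nat using (ℕ; _≤_; _*_)
open import Data.List using (List; length)
open import Relation.Binary.Definitions using (DecidableEquality)

open import Data.Bool using (true; false; T; if_then_else_)
open import Data.Empty using (⊥-elim)
open import Data.List using ([]; _∷_; _++_; take; drop; map; filter; deduplicate)
open import Data.List.Properties
  using (≡-dec; ∷-injectiveˡ; ∷-injectiveʳ; length-++; length-map; length-drop; drop-drop; drop-all; take-[]; take-drop; take-take; filter-all; filter-accept; filter-reject)
open import Data.List.Membership.Propositional using (_∈_)
open import Data.List.Membership.Propositional.Properties
  using (∈-∃++; ∈-++⁻; ∈-++⁺ˡ; ∈-++⁺ʳ; ∈-map⁻; ∈-map⁺; ∈-upTo⁺; ∈-deduplicate⁺)
open import Data.List.Relation.Binary.Subset.Propositional using (_⊆_)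
open import Data.List.Relation.Unary.All as All using (All; []; _∷_)
open import Data.List.Relation.Unary.All.Properties using (++⁺)
open import Data.List.Relation.Unary.AllPairs using (AllPairs; []; _∷_)
import Data.List.Relation.Unary.AllPairs.Properties as AllPairs
open import Data.List.Relation.Unary.Any using (here; there)
open import Data.List.Relation.Unary.Unique.Propositional using (Unique)
open import Data.Nat using (zero; suc; _+_; _∸_; _^_; _⊔_; _⊓_; _<_; _<ᵇ_; pred; z≤n; s≤s; s≤s⁻¹; NonZero; >-nonZero)
open import Data.Nat.Properties
open import Data.Nat.Solver using (module +-*-Solver)
open import Data.Product using (∃; _×_; _,_; proj₂)
open import Data.Sum using (_⊎_; inj₁; inj₂)
open import Data.Unit using (tt)
open import Function using (_on_)
open import Algebra.Properties.CommutativeSemigroup +-commutativeSemigroup using (xy∙z≈xz∙y)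
open import Relation.Binary.PropositionalEquality
open import Relation.Nullary using (yes; no; ¬_)
open import Relation.Nullary.Decidable using (_×-dec_)
open import Relation.Unary using (Decidable)
open import Relation.Unary.Properties using (U?; U-Universal)

Unique-⊆⇒length≤ : {B : Set} {xs ys : List B} → Unique xs → xs ⊆ ys → length xs ≤ length ys
Unique-⊆⇒length≤ {xs = []} _ _ = z≤n
Unique-⊆⇒length≤ {xs = x ∷ xs} (x∉xs ∷ xs!) xs⊆ys with ∈-∃++ (xs⊆ys (here refl))
... | ys₁ , ys₂ , refl = begin
  suc (length xs)             ≤⟨ s≤s (Unique-⊆⇒length≤ xs! xs⊆ys₁++ys₂) ⟩
  suc (length (ys₁ ++ ys₂))   ≡⟨ cong suc (length-++ ys₁) ⟩
  suc (length ys₁ + length ys₂) ≡⟨ sym (+-suc (length ys₁) (length ys₂)) ⟩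
  length ys₁ + length (x ∷ ys₂) ≡⟨ sym (length-++ ys₁) ⟩
  length (ys₁ ++ x ∷ ys₂)     ∎
  where
  open ≤-Reasoning
  xs⊆ys₁++ys₂ : xs ⊆ ys₁ ++ ys₂
  xs⊆ys₁++ys₂ v∈xs with ∈-++⁻ ys₁ (xs⊆ys (there v∈xs))
  ... | inj₁ v∈ys₁ = ∈-++⁺ˡ v∈ys₁
  ... | inj₂ (here refl) = ⊥-elim (All.lookup x∉xs v∈xs refl)
  ... | inj₂ (there v∈ys₂) = ∈-++⁺ʳ ys₁ v∈ys₂

count : {B : Set} {P : B → Set} → Decidable P → List B → ℕ
count P? xs = length (filter P? xs)

module _ {B : Set} {P : B → Set} (P? : Decidable P) where

  count-accept : ∀ {x xs} → P x → count P? (x ∷ xs) ≡ suc (count P? xs)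
  count-accept px = cong length (filter-accept P? px)

  count-reject : ∀ {x xs} → ¬ P x → count P? (x ∷ xs) ≡ count P? xs
  count-reject ¬px = cong length (filter-reject P? ¬px)

  count-∷ : ∀ x xs → count P? xs ≤ count P? (x ∷ xs)
  count-∷ x xs with P? x
  ... | yes _ = n≤1+n _
  ... | no _ = ≤-refl

count-⊎ : {B : Set} {P Q R : B → Set} (P? : Decidable P) (Q? : Decidable Q) (R? : Decidable R) →
  (∀ {x} → P x → Q x ⊎ R x) → ∀ xs → count P? xs ≤ count Q? xs + count R? xs
count-⊎ P? Q? R? split [] = z≤n
count-⊎ P? Q? R? split (x ∷ xs) with P? x
... | no _ = begin
  count P? xs                   ≤⟨ count-⊎ P? Q? R? split xs ⟩
  count Q? xs + count R? xs     ≤⟨ +-mono-≤ (count-∷ Q? x xs) (count-∷ R? x xs) ⟩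
  count Q? (x ∷ xs) + count R? (x ∷ xs) ∎
  where open ≤-Reasoning
... | yes px with split px
...   | inj₁ qx = begin
  suc (count P? xs)             ≤⟨ s≤s (count-⊎ P? Q? R? split xs) ⟩
  suc (count Q? xs + count R? xs) ≤⟨ s≤s (+-monoʳ-≤ (count Q? xs) (count-∷ R? x xs)) ⟩
  suc (count Q? xs) + count R? (x ∷ xs) ≡⟨ cong (_+ count R? (x ∷ xs)) (sym (count-accept Q? qx)) ⟩
  count Q? (x ∷ xs) + count R? (x ∷ xs) ∎
  where open ≤-Reasoning
...   | inj₂ rx = begin
  suc (count P? xs)             ≤⟨ s≤s (count-⊎ P? Q? R? split xs) ⟩
  suc (count Q? xs + count R? xs) ≤⟨ s≤s (+-monoˡ-≤ (count R? xs) (count-∷ Q? x xs)) ⟩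
  suc (count Q? (x ∷ xs) + count R? xs) ≡⟨ sym (+-suc _ _) ⟩
  count Q? (x ∷ xs) + suc (count R? xs) ≡⟨ cong (count Q? (x ∷ xs) +_) (sym (count-accept R? rx)) ⟩
  count Q? (x ∷ xs) + count R? (x ∷ xs) ∎
  where open ≤-Reasoning

length≤count+count : {B : Set} {Q R : B → Set} (Q? : Decidable Q) (R? : Decidable R) →
  (∀ x → Q x ⊎ R x) → ∀ xs → length xs ≤ count Q? xs + count R? xs
length≤count+count Q? R? split xs =
  subst (_≤ count Q? xs + count R? xs) (cong length (filter-all U? (All.universal U-Universal xs)))
    (count-⊎ U? Q? R? (λ {x} _ → split x) xs)

data Ascending : ℕ → ℕ → List ℕ → Set where
  []   : ∀ {f b} → Ascending f b []
  cons : ∀ {f b x xs} → f ≤ x → x < b → Ascending (suc x) b xs → Ascending f b (x ∷ xs)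

Ascending⇒All≥ : ∀ {f b xs} → Ascending f b xs → All (f ≤_) xs
Ascending⇒All≥ [] = []
Ascending⇒All≥ (cons f≤x _ rest) = f≤x ∷ All.map (≤-trans (m≤n⇒m≤1+n f≤x)) (Ascending⇒All≥ rest)

Ascending⇒All< : ∀ {f b xs} → Ascending f b xs → All (_< b) xs
Ascending⇒All< [] = []
Ascending⇒All< (cons _ x<b rest) = x<b ∷ Ascending⇒All< rest

Ascending-weaken : ∀ {f f′ b xs} → f′ ≤ f → Ascending f b xs → Ascending f′ b xs
Ascending-weaken _ [] = []
Ascending-weaken f′≤f (cons f≤x x<b rest) = cons (≤-trans f′≤f f≤x) x<b rest

Ascending-++ : ∀ {f g b xs ys} → f ≤ g → g ≤ b → Ascending f g xs → Ascending g b ys → Ascending f b (xs ++ ys)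
Ascending-++ f≤g _ [] ys↑ = Ascending-weaken f≤g ys↑
Ascending-++ _ g≤b (cons f≤x x<g xs↑) ys↑ = cons f≤x (≤-trans x<g g≤b) (Ascending-++ x<g g≤b xs↑ ys↑)

interval : ℕ → ℕ → List ℕ
interval a zero = []
interval a (suc k) = a ∷ interval (suc a) k

length-interval : ∀ a k → length (interval a k) ≡ k
length-interval a zero = refl
length-interval a (suc k) = cong suc (length-interval (suc a) k)

interval-ascending : ∀ a k → Ascending a (a + k) (interval a k)
interval-ascending a zero = []
interval-ascending a (suc k) rewrite +-suc a k =
  cons ≤-refl (s≤s (m≤m+n a k)) (interval-ascending (suc a) k)

block-before : ∀ f u s → f ≤ u → ∃ λ lo → f ≤ lo × lo ≤ u × u ≤ lo + s × s ≤ (u ∸ lo) + ((f + s) ∸ u)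
block-before f u s f≤u with f + s ≤? u
... | yes f+s≤u = u ∸ s , m+n≤o⇒m≤o∸n f f+s≤u , m∸n≤m u s , ≤-reflexive (sym (m∸n+n≡m s≤u)) ,
      ≤-trans (m≤m+n s _) (≤-reflexive (cong (_+ ((f + s) ∸ u)) (sym (m∸[m∸n]≡n s≤u))))
  where
  s≤u : s ≤ u
  s≤u = ≤-trans (m≤n+m s f) f+s≤u
... | no f+s≰u = f , ≤-refl , f≤u , <⇒≤ (≰⇒> f+s≰u) , ≤-trans (m≤n+m∸n s (u ∸ f)) (≤-reflexive (cong ((u ∸ f) +_) slack))
  where
  slack : s ∸ (u ∸ f) ≡ (f + s) ∸ u
  slack = trans (sym ([m+n]∸[m+o]≡n∸o f s (u ∸ f))) (cong ((f + s) ∸_) (m+[n∸m]≡n f≤u))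

dyadic : ∀ ℓ → 1 ≤ ℓ → ∃ λ K → 2 ^ K ≤ ℓ × ℓ < 2 ^ suc K
dyadic (suc zero) _ = 0 , ≤-refl , s≤s (s≤s z≤n)
dyadic (suc (suc y)) _ with dyadic (suc y) (s≤s z≤n)
... | K , lower , upper with suc (suc y) <? 2 ^ suc K
...   | yes below = K , m≤n⇒m≤1+n lower , below
...   | no ≮ = suc K , ≮⇒≥ ≮ , ≤-<-trans upper (m<m+n (2 ^ suc K) (≤-trans (m^n>0 2 (suc K)) (m≤m+n _ 0)))

LZBound-intro : ∀ c m ℓ₀ n K → 2 ^ K ≤ ℓ₀ → ℓ₀ * c ≤ 4 * n + K * (4 * m * ℓ₀) → LZBound c m ℓ₀ n
LZBound-intro c m ℓ₀ n K 2^K≤ℓ₀ bound = begin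
  2 ^ (ℓ₀ * c ∸ 4 * n)  ≤⟨ ^-monoʳ-≤ 2 (m≤n+o⇒m∸n≤o (ℓ₀ * c) (4 * n) bound) ⟩
  2 ^ (K * (4 * m * ℓ₀)) ≡⟨ sym (^-*-assoc 2 K (4 * m * ℓ₀)) ⟩
  (2 ^ K) ^ (4 * m * ℓ₀) ≤⟨ ^-monoˡ-≤ (4 * m * ℓ₀) 2^K≤ℓ₀ ⟩
  ℓ₀ ^ (4 * m * ℓ₀)     ∎
  where open ≤-Reasoning

LZBound-linear : ∀ c m ℓ₀ n → 1 ≤ ℓ₀ → ℓ₀ * c ≤ 4 * n → LZBound c m ℓ₀ n
LZBound-linear c m ℓ₀ n 1≤ℓ₀ bound = LZBound-intro c m ℓ₀ n 0 1≤ℓ₀ (≤-trans bound (m≤m+n (4 * n) 0))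

1+J*[3m+2]≤[1+J]*4m : ∀ J m → 2 ≤ m → 1 + J * (3 * m + 2) ≤ suc J * (4 * m)
1+J*[3m+2]≤[1+J]*4m J m 2≤m = +-mono-≤ (≤-trans (≤-trans (s≤s z≤n) 2≤m) (m≤m+n m _)) (*-monoʳ-≤ J 3m+2≤4m)
  where
  3m+2≤4m : 3 * m + 2 ≤ 4 * m
  3m+2≤4m = ≤-trans (+-monoʳ-≤ (3 * m) 2≤m) (≤-reflexive (+-comm (3 * m) m))

module LZ77 {A : Set} (_≟_ : DecidableEquality A) (w : List A) where

  n : ℕ
  n = length w

  window : ℕ → ℕ → List A
  window L a = take L (drop a w)

  Leftmost : ℕ → ℕ → Set
  Leftmost L a = ∀ p → p < a → window L p ≢ window L a

  window-drop : ∀ {δ k L} a → δ + k ≤ L → take k (drop δ (window L a)) ≡ window k (a + δ)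
  window-drop {δ} {k} {L} a δ+k≤L = begin
    take k (drop δ (take L (drop a w)))  ≡⟨ take-drop k δ _ ⟩
    drop δ (take (δ + k) (take L (drop a w))) ≡⟨ cong (drop δ) (take-take (δ + k) L _) ⟩
    drop δ (take ((δ + k) ⊓ L) (drop a w)) ≡⟨ cong (λ i → drop δ (take i (drop a w))) (m≤n⇒m⊓n≡m δ+k≤L) ⟩
    drop δ (take (δ + k) (drop a w))      ≡⟨ take-drop k δ _ ⟨
    take k (drop δ (drop a w))            ≡⟨ cong (take k) (drop-drop a δ w) ⟩
    take k (drop (a + δ) w)               ∎
    where open ≡-Reasoning

  Leftmost-⊇ : ∀ {k t L a} → Leftmost k t → a ≤ t → t + k ≤ a + L → Leftmost L a
  Leftmost-⊇ {k} {t} {L} {a} leftmost a≤t t+k≤a+L p p<a same =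
    leftmost (p + δ) (subst (p + δ <_) a+δ≡t (+-monoˡ-< δ p<a)) (begin
      window k (p + δ)                 ≡⟨ window-drop p δ+k≤L ⟨
      take k (drop δ (window L p))     ≡⟨ cong (λ v → take k (drop δ v)) same ⟩
      take k (drop δ (window L a))     ≡⟨ window-drop a δ+k≤L ⟩
      window k (a + δ)                 ≡⟨ cong (window k) a+δ≡t ⟩
      window k t                       ∎)
    where
    open ≡-Reasoning
    δ = t ∸ a
    a+δ≡t : a + δ ≡ t
    a+δ≡t = m+[n∸m]≡n a≤t
    δ+k≤L : δ + k ≤ L
    δ+k≤L = +-cancelˡ-≤ a _ _ (subst (_≤ a + L) (trans (cong (_+ k) (sym a+δ≡t)) (+-assoc a δ k)) t+k≤a+L)

  distinct-windows≤d : ∀ L as → Unique (map (window L) as) → All (_≤ n ∸ L) as → length as ≤ d _≟_ L w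
  distinct-windows≤d L as unique in-range = begin
    length as                  ≡⟨ length-map (window L) as ⟨
    length (map (window L) as) ≤⟨ Unique-⊆⇒length≤ unique substring ⟩
    d _≟_ L w                  ∎
    where
    open ≤-Reasoning
    substring : map (window L) as ⊆ deduplicate (≡-dec _≟_) (substringsOfLength L w)
    substring v∈ with ∈-map⁻ (window L) v∈
    ... | a , a∈as , refl = ∈-deduplicate⁺ (≡-dec _≟_) (∈-map⁺ (window L) (∈-upTo⁺ (s≤s (All.lookup in-range a∈as))))

  leftmost-windows≤d : ∀ L {as} → Ascending 0 (suc (n ∸ L)) as → All (Leftmost L) as → length as ≤ d _≟_ L w
  leftmost-windows≤d L {as} as↑ leftmost =
    distinct-windows≤d L as (AllPairs.map⁺ (distinct as↑ leftmost)) (All.map s≤s⁻¹ (Ascending⇒All< as↑))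
    where
    distinct : ∀ {f bs} → Ascending f (suc (n ∸ L)) bs → All (Leftmost L) bs → AllPairs (_≢_ on window L) bs
    distinct [] [] = []
    distinct {bs = b ∷ _} (cons _ _ rest) (_ ∷ leftmost-rest) =
      All.zipWith (λ (b<c , leftmost-c) → leftmost-c b b<c) (Ascending⇒All≥ rest , leftmost-rest)
      ∷ distinct rest leftmost-rest

  Novel : ℕ → ℕ → Set
  Novel t l = t + l < n → Leftmost (suc l) t

  -- Phrases are pairs (start , length); a literal output symbol is a phrase of length 1.
  data Parse (t : ℕ) : List (ℕ × ℕ) → Set where
    end    : t ≡ n → Parse t []
    phrase : ∀ {l ps} → 1 ≤ l → Novel t l → Parse (t + l) ps → Parse t ((t , l) ∷ ps)

  Parse⇒≤ : ∀ {t ps} → Parse t ps → t ≤ n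
  Parse⇒≤ (end t≡n) = ≤-reflexive t≡n
  Parse⇒≤ {t} (phrase {l} _ _ rest) = ≤-trans (m≤m+n t l) (Parse⇒≤ rest)

  Parse-end : ∀ {t ps} → Parse t ps → n ≤ t → ps ≡ []
  Parse-end (end _) _ = refl
  Parse-end {t} (phrase {l} 1≤l _ rest) n≤t =
    ⊥-elim (<⇒≱ 1≤l (+-cancelˡ-≤ t l 0 (≤-trans (Parse⇒≤ rest) (≤-trans n≤t (≤-reflexive (sym (+-identityʳ t)))))))

  Parse⇒length≤ : ∀ {t ps} → Parse t ps → t + length ps ≤ n
  Parse⇒length≤ {t} (end t≡n) = ≤-reflexive (trans (+-identityʳ t) t≡n)
  Parse⇒length≤ {t} (phrase {l} {ps} 1≤l _ rest) = begin
    t + suc (length ps)  ≡⟨ +-suc t (length ps) ⟩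
    suc t + length ps    ≤⟨ +-monoˡ-≤ (length ps) (subst (_≤ t + l) (+-comm t 1) (+-monoʳ-≤ t 1≤l)) ⟩
    t + l + length ps    ≤⟨ Parse⇒length≤ rest ⟩
    n                    ∎
    where open ≤-Reasoning

  lcp≤length : ∀ xs ys → lcp _≟_ xs ys ≤ length ys
  lcp≤length (x ∷ xs) (y ∷ ys) with x ≟ y
  ... | yes _ = s≤s (lcp≤length xs ys)
  ... | no _ = z≤n
  lcp≤length [] _ = z≤n
  lcp≤length (_ ∷ _) [] = z≤n

  take≡⇒≤lcp : ∀ k xs ys → take k xs ≡ take k ys → k ≤ length ys → k ≤ lcp _≟_ xs ys
  take≡⇒≤lcp zero _ _ _ _ = z≤n
  take≡⇒≤lcp (suc k) (x ∷ xs) (y ∷ ys) same (s≤s k≤) with x ≟ y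
  ... | yes _ = s≤s (take≡⇒≤lcp k xs ys (∷-injectiveʳ same) k≤)
  ... | no x≢y = ⊥-elim (x≢y (∷-injectiveˡ same))
  take≡⇒≤lcp (suc k) [] (y ∷ ys) () _
  take≡⇒≤lcp (suc k) _ [] _ ()

  proj₂-choose : ∀ (b : ℕ × ℕ) k l → proj₂ (if proj₂ b <ᵇ l then (k , l) else b) ≡ proj₂ b ⊔ l
  proj₂-choose b k l with proj₂ b <ᵇ l in better
  ... | true = sym (m≤n⇒m⊔n≡n (<⇒≤ (<ᵇ⇒< (proj₂ b) l (subst T (sym better) tt))))
  ... | false = sym (m≥n⇒m⊔n≡m (≮⇒≥ (λ b<l → subst T better (<⇒<ᵇ b<l))))

  bestFrom-suc : ∀ t k → proj₂ (bestFrom _≟_ w t (suc k)) ≡ proj₂ (bestFrom _≟_ w t k) ⊔ lcp _≟_ (drop k w) (drop t w)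
  bestFrom-suc t k = proj₂-choose (bestFrom _≟_ w t k) k (lcp _≟_ (drop k w) (drop t w))

  bestFrom≤ : ∀ t k → proj₂ (bestFrom _≟_ w t k) ≤ n ∸ t
  bestFrom≤ t zero = z≤n
  bestFrom≤ t (suc k) rewrite bestFrom-suc t k =
    ⊔-lub (bestFrom≤ t k) (subst (lcp _≟_ (drop k w) (drop t w) ≤_) (length-drop t w) (lcp≤length (drop k w) (drop t w)))

  lcp≤bestFrom : ∀ t k p → p < k → lcp _≟_ (drop p w) (drop t w) ≤ proj₂ (bestFrom _≟_ w t k)
  lcp≤bestFrom t (suc k) p p<1+k rewrite bestFrom-suc t k with m≤n⇒m<n∨m≡n (s≤s⁻¹ p<1+k)
  ... | inj₁ p<k = ≤-trans (lcp≤bestFrom t k p p<k) (m≤m⊔n _ _)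
  ... | inj₂ refl = m≤n⊔m _ _

  longestMatch-novel : ∀ t l → proj₂ (longestMatch _≟_ w t) ≤ l → Novel t l
  longestMatch-novel t l match≤l t+l<n p p<t same = <-irrefl refl (≤-trans longer match≤l)
    where
    longer : suc l ≤ proj₂ (longestMatch _≟_ w t)
    longer = ≤-trans
      (take≡⇒≤lcp (suc l) (drop p w) (drop t w) same
        (subst (suc l ≤_) (sym (length-drop t w)) (m+n≤o⇒m≤o∸n (suc l) (subst (λ i → suc i ≤ n) (+-comm t l) t+l<n))))
      (lcp≤bestFrom t t p p<t)

  longestMatch-fits : ∀ t → t ≤ n → t + proj₂ (longestMatch _≟_ w t) ≤ n
  longestMatch-fits t t≤n = ≤-trans (+-monoʳ-≤ t (bestFrom≤ t t)) (≤-reflexive (m+[n∸m]≡n t≤n))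

  drop≡[]⇒≥ : ∀ t → drop t w ≡ [] → n ≤ t
  drop≡[]⇒≥ t empty = m∸n≡0⇒m≤n (trans (sym (length-drop t w)) (cong length empty))

  fuel-step : ∀ {t t′ fuel} → t < t′ → n ∸ t ≤ suc fuel → n ∸ t′ ≤ fuel
  fuel-step {t} t<t′ n∸t≤ = ≤-trans (∸-monoʳ-≤ n t<t′) (≤-trans (≤-reflexive (sym (pred[m∸n]≡m∸[1+n] n t))) (pred-mono-≤ n∸t≤))

  drop≡∷⇒< : ∀ t {x xs} → drop t w ≡ x ∷ xs → t < n
  drop≡∷⇒< t nonempty with n ≤? t
  ... | no n≰t = ≰⇒> n≰t
  ... | yes n≤t with trans (sym (drop-all t w n≤t)) nonempty
  ...   | ()

  lzFrom-parse : ∀ fuel t → t ≤ n → n ∸ t ≤ fuel →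
    ∃ λ ps → Parse t ps × length (lzFrom _≟_ w fuel t) ≡ length ps
  lzFrom-parse zero t t≤n n∸t≤0 = [] , end (≤-antisym t≤n (m∸n≡0⇒m≤n (n≤0⇒n≡0 n∸t≤0))) , refl
  lzFrom-parse (suc fuel) t t≤n n∸t≤ with drop t w in suffix
  ... | [] = [] , end (≤-antisym t≤n (drop≡[]⇒≥ t suffix)) , refl
  ... | _ ∷ _ with longestMatch _≟_ w t in match
  ...   | _ , zero with lzFrom-parse fuel (suc t) (drop≡∷⇒< t suffix) (fuel-step ≤-refl n∸t≤)
  ...     | ps , parse , len =
    (t , 1) ∷ ps ,
    phrase ≤-refl (longestMatch-novel t 1 (subst (_≤ 1) (sym (cong proj₂ match)) z≤n)) (subst (λ t′ → Parse t′ ps) (+-comm 1 t) parse) ,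
    cong suc len
  lzFrom-parse (suc fuel) t t≤n n∸t≤ | _ ∷ _ | _ , suc l
    with lzFrom-parse fuel (t + suc l) (subst (λ k → t + k ≤ n) (cong proj₂ match) (longestMatch-fits t t≤n)) (fuel-step (m<m+n t (s≤s z≤n)) n∸t≤)
  ...     | ps , parse , len =
    (t , suc l) ∷ ps , phrase (s≤s z≤n) (longestMatch-novel t (suc l) (≤-reflexive (cong proj₂ match))) parse , cong suc len

  lz77-parse : ∃ λ ps → Parse 0 ps × C-LZ _≟_ w ≡ length ps
  lz77-parse = lzFrom-parse n 0 z≤n ≤-refl

  Last : ℕ × ℕ → Set
  Last (t , l) = n ≤ t + l

  last? : Decidable Last
  last? (t , l) = n ≤? t + l

  Inner : ℕ × ℕ → Set
  Inner (t , l) = t + l < n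

  inner? : Decidable Inner
  inner? (t , l) = suc (t + l) ≤? n

  Short : ℕ → ℕ × ℕ → Set
  Short q (t , l) = t + l < n × l < q

  short? : ∀ q → Decidable (Short q)
  short? q (t , l) = (suc (t + l) ≤? n) ×-dec (suc l ≤? q)

  LongIn : ℕ → ℕ → ℕ → ℕ × ℕ → Set
  LongIn R B q (t , l) = R ≤ t × t + l ≤ B × q ≤ l

  longIn? : ∀ R B q → Decidable (LongIn R B q)
  longIn? R B q (t , l) = (R ≤? t) ×-dec ((t + l ≤? B) ×-dec (q ≤? l))

  Level : ℕ → ℕ × ℕ → Set
  Level s (t , l) = t + l < n × s ≤ l × l < 2 * s

  level? : ∀ s → Decidable (Level s)
  level? s (t , l) = (suc (t + l) ≤? n) ×-dec ((s ≤? l) ×-dec (suc l ≤? 2 * s))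

  Roomy : ℕ → ℕ × ℕ → Set
  Roomy s (t , l) = s ≤ l × l < 2 * s × t + 3 * s ≤ n

  roomy? : ∀ s → Decidable (Roomy s)
  roomy? s (t , l) = (s ≤? l) ×-dec ((suc l ≤? 2 * s) ×-dec (t + 3 * s ≤? n))

  count-last≤1 : ∀ {t ps} → Parse t ps → count last? ps ≤ 1
  count-last≤1 (end _) = z≤n
  count-last≤1 {t} (phrase {l} _ _ rest) with last? (t , l)
  ... | yes n≤t+l rewrite Parse-end rest n≤t+l = ≤-reflexive (count-accept last? n≤t+l)
  ... | no ¬last = ≤-trans (≤-reflexive (count-reject last? ¬last)) (count-last≤1 rest)

  count-longIn : ∀ R B q {t ps} → Parse t ps → q * count (longIn? R B q) ps ≤ B ∸ (R ⊔ t)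
  count-longIn R B q (end _) = ≤-trans (≤-reflexive (*-zeroʳ q)) z≤n
  count-longIn R B q {t} (phrase {l} {ps} _ _ rest) with longIn? R B q (t , l)
  ... | no ¬long = begin
    q * count (longIn? R B q) ((t , l) ∷ ps) ≡⟨ cong (q *_) (count-reject (longIn? R B q) ¬long) ⟩
    q * count (longIn? R B q) ps ≤⟨ count-longIn R B q rest ⟩
    B ∸ (R ⊔ (t + l))            ≤⟨ ∸-monoʳ-≤ B (⊔-monoʳ-≤ R (m≤m+n t l)) ⟩
    B ∸ (R ⊔ t)                  ∎
    where open ≤-Reasoning
  ... | yes long@(R≤t , t+l≤B , q≤l) = begin
    q * count (longIn? R B q) ((t , l) ∷ ps) ≡⟨ cong (q *_) (count-accept (longIn? R B q) long) ⟩
    q * suc (count (longIn? R B q) ps)  ≡⟨ *-suc q _ ⟩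
    q + q * count (longIn? R B q) ps    ≤⟨ +-mono-≤ q≤l (count-longIn R B q rest) ⟩
    l + (B ∸ (R ⊔ (t + l)))             ≡⟨ cong (λ i → l + (B ∸ i)) (m≤n⇒m⊔n≡n (≤-trans R≤t (m≤m+n t l))) ⟩
    l + (B ∸ (t + l))                   ≡⟨ +-∸-assoc l t+l≤B ⟨
    (l + B) ∸ (t + l)                   ≡⟨ cong ((l + B) ∸_) (+-comm t l) ⟩
    (l + B) ∸ (l + t)                   ≡⟨ [m+n]∸[m+o]≡n∸o l B t ⟩
    B ∸ t                               ≡⟨ cong (B ∸_) (m≤n⇒m⊔n≡n R≤t) ⟨
    B ∸ (R ⊔ t)                         ∎
    where open ≤-Reasoning

  Novel⇒Leftmost : ∀ {s t l x} → Novel t l → l < 2 * s → t + 3 * s ≤ n → x ≤ t → suc t ≤ x + s → Leftmost (3 * s) x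
  Novel⇒Leftmost {s} {t} {l} {x} novel l<2s t+3s≤n x≤t 1+t≤x+s = Leftmost-⊇ (novel t+l<n) x≤t (begin
    t + suc l       ≤⟨ +-monoʳ-≤ t l<2s ⟩
    t + 2 * s       ≤⟨ +-monoˡ-≤ (2 * s) (≤-trans (n≤1+n t) 1+t≤x+s) ⟩
    x + s + 2 * s   ≡⟨ +-assoc x s (2 * s) ⟩
    x + 3 * s       ∎)
    where
    open ≤-Reasoning
    t+l<n : t + l < n
    t+l<n = begin-strict
      t + l      <⟨ +-monoʳ-< t l<2s ⟩
      t + 2 * s  ≤⟨ +-monoʳ-≤ t (m≤n+m (2 * s) s) ⟩
      t + 3 * s  ≤⟨ t+3s≤n ⟩
      n          ∎

  -- Every position below f is already claimed by an earlier block; the slack term pays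
  -- for the block of the first roomy phrase being cut off at f.
  roomy-blocks : ∀ s {t ps} → Parse t ps → ∀ f → f ≤ suc t →
    ∃ λ as → Ascending f (suc (n ∸ 3 * s)) as × All (Leftmost (3 * s)) as ×
             s * count (roomy? s) ps ≤ length as + ((f + s) ∸ suc t)
  roomy-blocks s (end _) f _ = [] , [] , [] , ≤-trans (≤-reflexive (*-zeroʳ s)) z≤n
  roomy-blocks s {t} (phrase {l} {ps} _ novel rest) f f≤1+t with roomy? s (t , l)
  ... | no ¬roomy with roomy-blocks s rest f (≤-trans f≤1+t (s≤s (m≤m+n t l)))
  ...   | as , as↑ , leftmost , bound = as , as↑ , leftmost , (begin
    s * count (roomy? s) ((t , l) ∷ ps)  ≡⟨ cong (s *_) (count-reject (roomy? s) ¬roomy) ⟩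
    s * count (roomy? s) ps              ≤⟨ bound ⟩
    length as + ((f + s) ∸ suc (t + l))  ≤⟨ +-monoʳ-≤ (length as) (∸-monoʳ-≤ (f + s) (s≤s (m≤m+n t l))) ⟩
    length as + ((f + s) ∸ suc t)        ∎)
    where open ≤-Reasoning
  roomy-blocks s {t} (phrase {l} {ps} _ novel rest) f f≤1+t | yes roomy@(s≤l , l<2s , t+3s≤n)
    with block-before f (suc t) s f≤1+t | roomy-blocks s rest (suc t) (s≤s (m≤m+n t l))
  ... | lo , f≤lo , lo≤1+t , 1+t≤lo+s , s≤block+slack | as , as↑ , leftmost , bound =
    blk ++ as ,
    Ascending-++ f≤1+t (s≤s (m+n≤o⇒m≤o∸n t t+3s≤n)) (Ascending-weaken f≤lo blk↑) as↑ ,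
    ++⁺ (All.tabulate blk-leftmost) leftmost ,
    count-bound
    where
    blk = interval lo (suc t ∸ lo)
    slack = (f + s) ∸ suc t
    blk↑ : Ascending lo (suc t) blk
    blk↑ = subst (λ b → Ascending lo b blk) (m+[n∸m]≡n lo≤1+t) (interval-ascending lo (suc t ∸ lo))
    blk-leftmost : ∀ {x} → x ∈ blk → Leftmost (3 * s) x
    blk-leftmost x∈blk = Novel⇒Leftmost novel l<2s t+3s≤n
      (s≤s⁻¹ (All.lookup (Ascending⇒All< blk↑) x∈blk))
      (≤-trans 1+t≤lo+s (+-monoˡ-≤ s (All.lookup (Ascending⇒All≥ blk↑) x∈blk)))
    open ≤-Reasoning
    count-bound : s * count (roomy? s) ((t , l) ∷ ps) ≤ length (blk ++ as) + slack
    count-bound = begin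
      s * count (roomy? s) ((t , l) ∷ ps)  ≡⟨ cong (s *_) (count-accept (roomy? s) roomy) ⟩
      s * suc (count (roomy? s) ps)        ≡⟨ *-suc s _ ⟩
      s + s * count (roomy? s) ps          ≤⟨ +-mono-≤ s≤block+slack bound ⟩
      (suc t ∸ lo) + slack + (length as + ((suc t + s) ∸ suc (t + l)))
        ≡⟨ cong (λ e → (suc t ∸ lo) + slack + (length as + e)) (m≤n⇒m∸n≡0 (s≤s (+-monoʳ-≤ t s≤l))) ⟩
      (suc t ∸ lo) + slack + (length as + 0) ≡⟨ cong ((suc t ∸ lo) + slack +_) (+-identityʳ (length as)) ⟩
      (suc t ∸ lo) + slack + length as     ≡⟨ xy∙z≈xz∙y (suc t ∸ lo) slack (length as) ⟩
      (suc t ∸ lo) + length as + slack     ≡⟨ cong (λ k → k + length as + slack) (length-interval lo (suc t ∸ lo)) ⟨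
      length blk + length as + slack       ≡⟨ cong (_+ slack) (length-++ blk) ⟨
      length (blk ++ as) + slack           ∎

  count-roomy≤ : ∀ s m {ps} → 1 ≤ s → Parse 0 ps → d _≟_ (3 * s) w ≤ m * (3 * s) → count (roomy? s) ps ≤ 3 * m
  count-roomy≤ s m {ps} 1≤s parse d≤ with roomy-blocks s parse 0 z≤n
  ... | as , as↑ , leftmost , bound = s≤s⁻¹ (*-cancelˡ-< s _ _ (begin-strict
    s * count (roomy? s) ps  ≤⟨ bound ⟩
    length as + (s ∸ 1)      <⟨ +-mono-≤-< (≤-trans (leftmost-windows≤d (3 * s) as↑ leftmost) d≤) (≤-reflexive (m+[n∸m]≡n 1≤s)) ⟩
    m * (3 * s) + s          ≡⟨ solve 2 (λ m s → m :* (con 3 :* s) :+ s := s :* (con 1 :+ con 3 :* m)) refl m s ⟩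
    s * suc (3 * m)          ∎))
    where
    open ≤-Reasoning
    open +-*-Solver

  -- A level-s phrase without room for a 3s-window at its start lies among the last
  -- 3s - 1 positions, where at most two disjoint phrases of length ≥ s fit.
  count-level≤ : ∀ s m {ps} → 1 ≤ s → Parse 0 ps → d _≟_ (3 * s) w ≤ m * (3 * s) → count (level? s) ps ≤ 3 * m + 2
  count-level≤ s m {ps} 1≤s parse d≤ = begin
    count (level? s) ps                                ≤⟨ count-⊎ (level? s) (roomy? s) (longIn? R (pred n) s) split ps ⟩
    count (roomy? s) ps + count (longIn? R (pred n) s) ps ≤⟨ +-mono-≤ (count-roomy≤ s m 1≤s parse d≤) (s≤s⁻¹ count-tail<3) ⟩
    3 * m + 2                                          ∎
    where
    open ≤-Reasoning
    R = suc n ∸ 3 * s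
    split : ∀ {p} → Level s p → Roomy s p ⊎ LongIn R (pred n) s p
    split {t , l} (t+l<n , s≤l , l<2s) with t + 3 * s ≤? n
    ... | yes t+3s≤n = inj₁ (s≤l , l<2s , t+3s≤n)
    ... | no t+3s≰n = inj₂ (m≤n+o⇒m∸n≤o (suc n) (3 * s) (≤-trans (≰⇒> t+3s≰n) (≤-reflexive (+-comm t (3 * s)))) , <⇒≤pred t+l<n , s≤l)
    instance
      3s≢0 : NonZero (3 * s)
      3s≢0 = >-nonZero (≤-trans 1≤s (m≤m+n s _))
    tail-region : pred n ∸ (R ⊔ 0) < 3 * s
    tail-region = subst (λ r → pred n ∸ r < 3 * s) (sym (⊔-identityʳ R)) (m<n+o⇒m∸n<o (pred n) R (begin-strict
      pred n                 <⟨ s≤s pred[n]≤n ⟩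
      suc n                  ≤⟨ m≤n+m∸n (suc n) (3 * s) ⟩
      3 * s + R              ≡⟨ +-comm (3 * s) R ⟩
      R + 3 * s              ∎))
    count-tail<3 : count (longIn? R (pred n) s) ps < 3
    count-tail<3 = *-cancelˡ-< s _ 3 (begin-strict
      s * count (longIn? R (pred n) s) ps ≤⟨ count-longIn R (pred n) s parse ⟩
      pred n ∸ (R ⊔ 0)                    <⟨ tail-region ⟩
      3 * s                               ≡⟨ *-comm 3 s ⟩
      s * 3                               ∎)

  count-short-1≡0 : ∀ {t ps} → Parse t ps → count (short? 1) ps ≡ 0
  count-short-1≡0 (end _) = refl
  count-short-1≡0 (phrase 1≤l _ rest) =
    trans (count-reject (short? 1) (λ (_ , l<1) → <⇒≱ l<1 1≤l)) (count-short-1≡0 rest)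

  count-short≤ : ∀ m J {ps} → Parse 0 ps → (∀ j → j < J → d _≟_ (3 * 2 ^ j) w ≤ m * (3 * 2 ^ j)) →
    count (short? (2 ^ J)) ps ≤ J * (3 * m + 2)
  count-short≤ m zero parse _ = ≤-reflexive (count-short-1≡0 parse)
  count-short≤ m (suc J) {ps} parse d≤ = begin
    count (short? (2 ^ suc J)) ps                        ≤⟨ count-⊎ (short? (2 ^ suc J)) (short? q) (level? q) split ps ⟩
    count (short? q) ps + count (level? q) ps            ≤⟨ +-mono-≤ shorter (count-level≤ q m (m^n>0 2 J) parse (d≤ J ≤-refl)) ⟩
    J * (3 * m + 2) + (3 * m + 2)                        ≡⟨ +-comm _ (3 * m + 2) ⟩
    suc J * (3 * m + 2)                                  ∎
    where
    open ≤-Reasoning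
    q = 2 ^ J
    split : ∀ {p} → Short (2 * q) p → Short q p ⊎ Level q p
    split {t , l} (t+l<n , l<2q) with suc l ≤? q
    ... | yes l<q = inj₁ (t+l<n , l<q)
    ... | no l≮q = inj₂ (t+l<n , ≮⇒≥ l≮q , l<2q)
    shorter : count (short? q) ps ≤ J * (3 * m + 2)
    shorter = count-short≤ m J parse (λ j j<J → d≤ j (m<n⇒m<1+n j<J))

  length-parse≤ : ∀ m J {ps} → Parse 0 ps → (∀ j → j < J → d _≟_ (3 * 2 ^ j) w ≤ m * (3 * 2 ^ j)) →
    length ps ≤ 1 + J * (3 * m + 2) + count (longIn? 0 n (2 ^ J)) ps
  length-parse≤ m J {ps} parse d≤ = begin
    length ps                                  ≤⟨ length≤count+count last? inner? last-or-inner ps ⟩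
    count last? ps + count inner? ps           ≤⟨ +-mono-≤ (count-last≤1 parse) (count-⊎ inner? (short? q) (longIn? 0 n q) split ps) ⟩
    1 + (count (short? q) ps + count (longIn? 0 n q) ps) ≤⟨ +-monoʳ-≤ 1 (+-monoˡ-≤ _ (count-short≤ m J parse d≤)) ⟩
    1 + (J * (3 * m + 2) + count (longIn? 0 n q) ps)     ≡⟨ +-assoc 1 (J * (3 * m + 2)) (count (longIn? 0 n q) ps) ⟨
    1 + J * (3 * m + 2) + count (longIn? 0 n q) ps       ∎
    where
    open ≤-Reasoning
    q = 2 ^ J
    last-or-inner : ∀ p → Last p ⊎ Inner p
    last-or-inner (t , l) with n ≤? t + l
    ... | yes n≤t+l = inj₁ n≤t+l
    ... | no n≰t+l = inj₂ (≰⇒> n≰t+l)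
    split : ∀ {p} → Inner p → Short q p ⊎ LongIn 0 n q p
    split {t , l} t+l<n with suc l ≤? q
    ... | yes l<q = inj₁ (t+l<n , l<q)
    ... | no l≮q = inj₂ (z≤n , <⇒≤ t+l<n , ≮⇒≥ l≮q)

  window-suc : ∀ k p → window (suc k) p ≡ window 1 p ++ window k (suc p)
  window-suc k p = take-suc-drop p w
    where
    take-suc-drop : ∀ p (xs : List A) → take (suc k) (drop p xs) ≡ take 1 (drop p xs) ++ take k (drop (suc p) xs)
    take-suc-drop zero [] = sym (take-[] k)
    take-suc-drop zero (_ ∷ _) = refl
    take-suc-drop (suc p) [] = sym (take-[] k)
    take-suc-drop (suc p) (_ ∷ xs) = take-suc-drop p xs

  letters-equal : d _≟_ 1 w ≤ 1 → ∀ {a b} → a < n → b < n → window 1 a ≡ window 1 b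
  letters-equal d≤1 {a} {b} a<n b<n with ≡-dec _≟_ (window 1 a) (window 1 b)
  ... | yes same = same
  ... | no differ = ⊥-elim (<-irrefl refl (≤-trans two-windows d≤1))
    where
    in-range : ∀ {x} → x < n → x ≤ n ∸ 1
    in-range {x} x<n = m+n≤o⇒m≤o∸n x (subst (_≤ n) (+-comm 1 x) x<n)
    two-windows : 2 ≤ d _≟_ 1 w
    two-windows = distinct-windows≤d 1 (a ∷ b ∷ []) ((differ ∷ []) ∷ [] ∷ []) (in-range a<n ∷ in-range b<n ∷ [])

  windows-equal : d _≟_ 1 w ≤ 1 → ∀ k p q → p + k ≤ n → q + k ≤ n → window k p ≡ window k q
  windows-equal d≤1 zero _ _ _ _ = refl
  windows-equal d≤1 (suc k) p q p+k≤n q+k≤n = begin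
    window (suc k) p                ≡⟨ window-suc k p ⟩
    window 1 p ++ window k (suc p)  ≡⟨ cong₂ _++_ (letters-equal d≤1 (start<n p p+k≤n) (start<n q q+k≤n))
                                                   (windows-equal d≤1 k (suc p) (suc q) (shift p p+k≤n) (shift q q+k≤n)) ⟩
    window 1 q ++ window k (suc q)  ≡⟨ window-suc k q ⟨
    window (suc k) q                ∎
    where
    open ≡-Reasoning
    start<n : ∀ x → x + suc k ≤ n → x < n
    start<n x x+k≤n = <-≤-trans (m<m+n x (s≤s z≤n)) x+k≤n
    shift : ∀ x → x + suc k ≤ n → suc x + k ≤ n
    shift x = subst (_≤ n) (+-suc x k)

  constant-parse : d _≟_ 1 w ≤ 1 → ∀ {ps} → Parse 0 ps → length ps ≤ 2
  constant-parse d≤1 (end _) = z≤n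
  constant-parse d≤1 (phrase 1≤l _ rest) = s≤s (at-most-one rest 1≤l)
    where
    at-most-one : ∀ {t ps} → Parse t ps → 1 ≤ t → length ps ≤ 1
    at-most-one (end _) _ = z≤n
    at-most-one {t} (phrase {l} _ novel rest) 1≤t with t + l <? n
    ... | no t+l≮n rewrite Parse-end rest (≮⇒≥ t+l≮n) = ≤-refl
    ... | yes t+l<n = ⊥-elim (novel t+l<n 0 1≤t
            (windows-equal d≤1 (suc l) 0 t (≤-trans (m≤n+m (suc l) t) t+l+1≤n) t+l+1≤n))
      where
      t+l+1≤n : t + suc l ≤ n
      t+l+1≤n = subst (_≤ n) (sym (+-suc t l)) t+l<n

  ℓ₀*length-parse≤ : ∀ ℓ₀ m J {ps} → 2 ≤ m → 2 ^ suc J ≤ ℓ₀ → ℓ₀ < 2 ^ suc (suc J) →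
    (∀ ℓ → 1 ≤ ℓ → ℓ ≤ ℓ₀ → d _≟_ ℓ w ≤ m * ℓ) → Parse 0 ps →
    ℓ₀ * length ps ≤ 4 * n + suc J * (4 * m * ℓ₀)
  ℓ₀*length-parse≤ ℓ₀ m J {ps} 2≤m 2^[1+J]≤ℓ₀ ℓ₀<2^[2+J] d≤ parse = begin
    ℓ₀ * length ps                              ≤⟨ *-monoʳ-≤ ℓ₀ (length-parse≤ m J parse level-hypothesis) ⟩
    ℓ₀ * (1 + J * (3 * m + 2) + W)              ≡⟨ *-distribˡ-+ ℓ₀ _ W ⟩
    ℓ₀ * (1 + J * (3 * m + 2)) + ℓ₀ * W         ≤⟨ +-mono-≤ (*-monoʳ-≤ ℓ₀ (1+J*[3m+2]≤[1+J]*4m J m 2≤m)) ℓ₀W≤4n ⟩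
    ℓ₀ * (suc J * (4 * m)) + 4 * n              ≡⟨ +-comm _ (4 * n) ⟩
    4 * n + ℓ₀ * (suc J * (4 * m))              ≡⟨ cong (4 * n +_) (trans (*-comm ℓ₀ _) (*-assoc (suc J) (4 * m) ℓ₀)) ⟩
    4 * n + suc J * (4 * m * ℓ₀)                ∎
    where
    open ≤-Reasoning
    q = 2 ^ J
    W = count (longIn? 0 n q) ps
    level-hypothesis : ∀ j → j < J → d _≟_ (3 * 2 ^ j) w ≤ m * (3 * 2 ^ j)
    level-hypothesis j j<J = d≤ (3 * 2 ^ j) (≤-trans (m^n>0 2 j) (m≤m+n _ _)) (begin
      3 * 2 ^ j        ≤⟨ *-monoˡ-≤ (2 ^ j) (n≤1+n 3) ⟩
      4 * 2 ^ j        ≡⟨ *-assoc 2 2 (2 ^ j) ⟩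
      2 ^ suc (suc j)  ≤⟨ ^-monoʳ-≤ 2 (s≤s j<J) ⟩
      2 ^ suc J        ≤⟨ 2^[1+J]≤ℓ₀ ⟩
      ℓ₀               ∎)
    ℓ₀W≤4n : ℓ₀ * W ≤ 4 * n
    ℓ₀W≤4n = begin
      ℓ₀ * W             ≤⟨ *-monoˡ-≤ W (<⇒≤ ℓ₀<2^[2+J]) ⟩
      2 * (2 * q) * W    ≡⟨ cong (_* W) (*-assoc 2 2 q) ⟨
      4 * q * W          ≡⟨ *-assoc 4 q W ⟩
      4 * (q * W)        ≤⟨ *-monoʳ-≤ 4 (count-longIn 0 n q parse) ⟩
      4 * n              ∎

  lz77-bound : ∀ ℓ₀ m {ps} → 1 ≤ ℓ₀ → ℓ₀ ≤ n → (∀ ℓ → 1 ≤ ℓ → ℓ ≤ ℓ₀ → d _≟_ ℓ w ≤ m * ℓ) →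
    Parse 0 ps → LZBound (length ps) m ℓ₀ n
  lz77-bound ℓ₀ m {ps} 1≤ℓ₀ ℓ₀≤n d≤ parse with m ≤? 1 | dyadic ℓ₀ 1≤ℓ₀
  ... | yes m≤1 | _ = LZBound-linear (length ps) m ℓ₀ n 1≤ℓ₀ (begin
    ℓ₀ * length ps  ≤⟨ *-mono-≤ ℓ₀≤n (constant-parse d₁≤1 parse) ⟩
    n * 2           ≤⟨ *-monoʳ-≤ n (s≤s (s≤s z≤n)) ⟩
    n * 4           ≡⟨ *-comm n 4 ⟩
    4 * n           ∎)
    where
    open ≤-Reasoning
    d₁≤1 : d _≟_ 1 w ≤ 1
    d₁≤1 = ≤-trans (d≤ 1 ≤-refl 1≤ℓ₀) (≤-trans (≤-reflexive (*-identityʳ m)) m≤1)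
  ... | no _ | zero , _ , ℓ₀<2 =
    LZBound-linear (length ps) m ℓ₀ n 1≤ℓ₀ (≤-trans (*-mono-≤ (s≤s⁻¹ ℓ₀<2) (Parse⇒length≤ parse)) (*-monoˡ-≤ n {1} {4} (s≤s z≤n)))
  ... | no m≰1 | suc J , 2^[1+J]≤ℓ₀ , ℓ₀<2^[2+J] =
    LZBound-intro (length ps) m ℓ₀ n (suc J) 2^[1+J]≤ℓ₀ (ℓ₀*length-parse≤ ℓ₀ m J (≰⇒> m≰1) 2^[1+J]≤ℓ₀ ℓ₀<2^[2+J] d≤ parse)

mainTheorem4 : {A : Set} (_≟_ : DecidableEquality A) (w : List A) (ℓ₀ m : ℕ) →
    1 ≤ ℓ₀ → ℓ₀ ≤ length w →
    ((ℓ : ℕ) → 1 ≤ ℓ → ℓ ≤ ℓ₀ → d _≟_ ℓ w ≤ m * ℓ) →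
    LZBound (C-LZ _≟_ w) m ℓ₀ (length w)
mainTheorem4 _≟_ w ℓ₀ m 1≤ℓ₀ ℓ₀≤n d≤ with LZ77.lz77-parse _≟_ w
... | ps , parse , C≡length rewrite C≡length = LZ77.lz77-bound _≟_ w ℓ₀ m 1≤ℓ₀ ℓ₀≤n d≤ parse
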